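{- Let $F$ be a natural graph containing pairwise vertex-disjoint subgraphs $F_1,\dots,F_s$. Then $$\kappa(F)\ge\prod_{i=1}^s\kappa(F_i).$$
   Context: A natural graph is a simple graph whose vertex set is a finite subset of $\mathbb{N}=\{1,2,\dots\}$; subgraphs of a natural graph are again natural graphs. An infinite permutation of $\mathbb{N}$ is a sequence $(\pi(1),\pi(2),\dots)$ in which every positive integer occurs exactly once. For a natural graph $G$, two infinite permutations $\pi,\sigma$ are $G$-different if $\{\pi(i),\sigma(i)\}\in E(G)$ for some $i$. $\kappa(G)$ is the maximum cardinality of a set of pairwise $G$-different infinite permutations. -}

module Defs where

open import Data.Nat using (ℕ; _*_)
open import Data.Fin using (Fin; zero; suc)
open import Data.Product using (Σ; ∃; _×_; _,_)
open import Data.Sum using (_⊎_)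
open import Data.List using (List)
open import Data.List.Membership.Propositional using (_∈_)
open import Relation.Binary.PropositionalEquality using (_≡_; _≢_)
open import Function.Bundles using (_↔_; Inverse)

-- Convention: the positive integers {1,2,...} are encoded by ℕ = {0,1,...}
-- via k ↦ k+1.  This is a pure relabelling.

record NatGraph : Set where
  field
    V       : List ℕ
    E       : List (ℕ × ℕ)
    edge-ok : ∀ {x y} → (x , y) ∈ E → x ∈ V × y ∈ V × x ≢ y
open NatGraph public

Adj : NatGraph → ℕ → ℕ → Set
Adj G x y = ((x , y) ∈ E G) ⊎ ((y , x) ∈ E G)

_⊑_ : NatGraph → NatGraph → Set
H ⊑ G = (∀ {v} → v ∈ V H → v ∈ V G) × (∀ {x y} → Adj H x y → Adj G x y)

InfPerm : Set
InfPerm = ℕ ↔ ℕ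

GDiff : NatGraph → InfPerm → InfPerm → Set
GDiff G π σ = ∃ λ i → Adj G (Inverse.to π i) (Inverse.to σ i)

PairwiseDiff : NatGraph → (k : ℕ) → (Fin k → InfPerm) → Set
PairwiseDiff G k P = ∀ a b → a ≢ b → GDiff G (P a) (P b)

κ≥ : NatGraph → ℕ → Set
κ≥ G k = Σ (Fin k → InfPerm) (PairwiseDiff G k)

∏ : (s : ℕ) → (Fin s → ℕ) → ℕ
∏ ℕ.zero    f = 1
∏ (ℕ.suc s) f = f zero * ∏ s (λ i → f (suc i))

-- By induction on s it suffices to combine a family P of pairwise
-- F₁-different permutations with a family Q of pairwise F₂-different ones,
-- for vertex-disjoint F₁ and F₂.  For each pair (a , b) choose τ with
-- τ (2i) = P a i whenever P a i is a vertex of F₁ and τ (2i+1) = Q b i whenever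
-- Q b i is a vertex of F₂.  Disjointness makes these prescriptions a finite
-- partial injection, and such a map extends to a permutation of ℕ by composing
-- transpositions.  Pairs with different first components are then separated
-- by an edge of F₁ at an even position, the others by an edge of F₂ at an odd one.
module Submission where

open import Defs
open import Data.Nat using (ℕ; zero; suc; _*_)
open import Data.Nat.Properties using (*-cancelˡ-≡; even≢odd; suc-injective)
import Data.Nat
import Data.Fin as Fin
open import Data.Fin using (Fin)
open import Data.Fin.Properties using (*↔×; 0≢1+n)
import Data.Fin.Properties as Finₚ
open import Data.List using (List; []; _∷_; map; _++_; concatMap; allFin)
open import Data.List.Membership.Propositional using (_∈_)
open import Data.List.Membership.Propositional.Properties
  using (∈-map⁺; ∈-map⁻; ∈-++⁺ˡ; ∈-++⁺ʳ; ∈-++⁻; ∈-concat⁺′; ∈-concat⁻′; ∈-allFin)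
open import Data.List.Relation.Binary.Disjoint.Propositional using (Disjoint)
open import Data.List.Relation.Unary.Any using (here; there)
open import Data.Product using (Σ; ∃; _×_; _,_; proj₁; proj₂)
open import Data.Sum using (inj₁; inj₂)
open import Function using (_∘_; Injective)
open import Function.Bundles using (_↔_; Inverse; Injection; mk↔ₛ′)
open import Function.Properties.Inverse using (↔⇒↣)
open import Function.Construct.Composition using (_↔-∘_)
open import Function.Construct.Identity using (↔-id)
open import Function.Construct.Symmetry using (↔-sym)
open import Relation.Binary.Core using (_⇒_)
open import Relation.Binary.Construct.Union using (_∪_)
open import Relation.Binary.Definitions using (DecidableEquality)
open import Relation.Binary.PropositionalEquality
  using (_≡_; _≢_; refl; sym; trans; cong; subst; subst₂)
open import Relation.Nullary using (Dec; yes; no; contradiction)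

module PartialInjections {A : Set} (_≟_ : DecidableEquality A) where

  transpose : A → A → A → A
  transpose a b x with x ≟ a
  ... | yes _ = b
  ... | no _ with x ≟ b
  ...   | yes _ = a
  ...   | no _ = x

  transpose-matchˡ : ∀ a b → transpose a b a ≡ b
  transpose-matchˡ a b with a ≟ a
  ... | yes _ = refl
  ... | no a≢a = contradiction refl a≢a

  transpose-matchʳ : ∀ a b → transpose a b b ≡ a
  transpose-matchʳ a b with b ≟ a
  ... | yes refl = refl
  ... | no _ with b ≟ b
  ...   | yes _ = refl
  ...   | no b≢b = contradiction refl b≢b

  transpose-noMatch : ∀ {a b x} → x ≢ a → x ≢ b → transpose a b x ≡ x
  transpose-noMatch {a} {b} {x} x≢a x≢b with x ≟ a
  ... | yes x≡a = contradiction x≡a x≢a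
  ... | no _ with x ≟ b
  ...   | yes x≡b = contradiction x≡b x≢b
  ...   | no _ = refl

  transpose-involutive : ∀ a b x → transpose a b (transpose a b x) ≡ x
  transpose-involutive a b x with x ≟ a
  ... | yes refl = transpose-matchʳ x b
  ... | no x≢a with x ≟ b
  ...   | yes refl = transpose-matchˡ a x
  ...   | no x≢b = transpose-noMatch x≢a x≢b

  transposition : A → A → A ↔ A
  transposition a b = mk↔ₛ′ (transpose a b) (transpose a b)
    (transpose-involutive a b) (transpose-involutive a b)

  PartialInjection : List (A × A) → Set
  PartialInjection L = ∀ {p v q w} → (p , v) ∈ L → (q , w) ∈ L →
                       (p ≡ q → v ≡ w) × (v ≡ w → p ≡ q)

  extend : List (A × A) → A ↔ A
  extend []            = ↔-id A
  extend ((p , v) ∷ L) = transposition (Inverse.to (extend L) p) v ↔-∘ extend L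

  -- The transposition added for (p , v) fixes every earlier value w: by
  -- injectivity w ≢ v and w ≢ τ p, unless w ≡ v ≡ τ p.
  extend-agrees : ∀ L → PartialInjection L →
                  ∀ {p v} → (p , v) ∈ L → Inverse.to (extend L) p ≡ v
  extend-agrees ((p , v) ∷ L) inj (here refl) = transpose-matchˡ _ v
  extend-agrees ((p , v) ∷ L) inj {q} {w} (there qw∈L) =
    trans (cong (transpose (τ p) v) τq≡w) (fixes-w (w ≟ v))
    where
    τ : A → A
    τ = Inverse.to (extend L)

    τq≡w : τ q ≡ w
    τq≡w = extend-agrees L (λ a b → inj (there a) (there b)) qw∈L

    p≡q⇔v≡w : (p ≡ q → v ≡ w) × (v ≡ w → p ≡ q)
    p≡q⇔v≡w = inj (here refl) (there qw∈L)

    fixes-w : Dec (w ≡ v) → transpose (τ p) v w ≡ w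
    fixes-w (yes w≡v) =
      trans (cong (λ a → transpose a v w) (trans (cong τ (proj₂ p≡q⇔v≡w (sym w≡v))) τq≡w))
            (trans (transpose-matchˡ w v) (sym w≡v))
    fixes-w (no w≢v) = transpose-noMatch w≢τp w≢v
      where
      w≢τp : w ≢ τ p
      w≢τp w≡τp = w≢v (sym (proj₁ p≡q⇔v≡w
        (Injection.injective (↔⇒↣ (extend L)) (trans (sym w≡τp) (sym τq≡w)))))

  inverseGraph-partialInjection : ∀ {f : A → A} → Injective _≡_ _≡_ f →
                                  ∀ W → PartialInjection (map (λ v → f v , v) W)
  inverseGraph-partialInjection {f} f-injective W m m′
    with ∈-map⁻ (λ v → f v , v) m | ∈-map⁻ (λ v → f v , v) m′
  ... | _ , _ , refl | _ , _ , refl = f-injective , cong f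

  ++-partialInjection : ∀ {L M} → PartialInjection L → PartialInjection M →
                        (∀ {p v q w} → (p , v) ∈ L → (q , w) ∈ M → p ≢ q × v ≢ w) →
                        PartialInjection (L ++ M)
  ++-partialInjection {L} injL injM apart m m′ with ∈-++⁻ L m | ∈-++⁻ L m′
  ... | inj₁ a | inj₁ b = injL a b
  ... | inj₂ a | inj₂ b = injM a b
  ... | inj₁ a | inj₂ b = (λ p≡q → contradiction p≡q (proj₁ (apart a b)))
                        , (λ v≡w → contradiction v≡w (proj₂ (apart a b)))
  ... | inj₂ a | inj₁ b = (λ p≡q → contradiction (sym p≡q) (proj₁ (apart b a)))
                        , (λ v≡w → contradiction (sym v≡w) (proj₂ (apart b a)))

open PartialInjections Data.Nat._≟_
  using (PartialInjection; extend; extend-agrees;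
         inverseGraph-partialInjection; ++-partialInjection)
open Inverse using (to; from; strictlyInverseʳ)

interleave : ∀ {W₁ W₂} → Disjoint W₁ W₂ → (π σ : InfPerm) → Σ InfPerm λ τ →
             (∀ i → to π i ∈ W₁ → to τ (2 * i) ≡ to π i) ×
             (∀ i → to σ i ∈ W₂ → to τ (suc (2 * i)) ≡ to σ i)
interleave {W₁} {W₂} W₁∩W₂≡∅ π σ = extend L , agrees-even , agrees-odd
  where
  evenPos oddPos : ℕ → ℕ
  evenPos v = 2 * from π v
  oddPos  w = suc (2 * from σ w)

  Lπ Lσ L : List (ℕ × ℕ)
  Lπ = map (λ v → evenPos v , v) W₁
  Lσ = map (λ w → oddPos w , w) W₂
  L  = Lπ ++ Lσ

  from-injective : ∀ (ρ : InfPerm) → Injective _≡_ _≡_ (from ρ)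
  from-injective ρ = Injection.injective (↔⇒↣ (↔-sym ρ))

  apart : ∀ {p v q w} → (p , v) ∈ Lπ → (q , w) ∈ Lσ → p ≢ q × v ≢ w
  apart m m′ with ∈-map⁻ (λ v → evenPos v , v) m | ∈-map⁻ (λ w → oddPos w , w) m′
  ... | v , v∈W₁ , refl | w , w∈W₂ , refl =
    even≢odd (from π v) (from σ w) , λ { refl → W₁∩W₂≡∅ (v∈W₁ , w∈W₂) }

  L-injective : PartialInjection L
  L-injective = ++-partialInjection
    (inverseGraph-partialInjection (λ e → from-injective π (*-cancelˡ-≡ _ _ 2 e)) W₁)
    (inverseGraph-partialInjection (λ e → from-injective σ (*-cancelˡ-≡ _ _ 2 (suc-injective e))) W₂)
    apart

  agrees-even : ∀ i → to π i ∈ W₁ → to (extend L) (2 * i) ≡ to π i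
  agrees-even i πi∈W₁ = subst (λ j → to (extend L) (2 * j) ≡ to π i) (strictlyInverseʳ π i)
    (extend-agrees L L-injective (∈-++⁺ˡ (∈-map⁺ (λ v → evenPos v , v) πi∈W₁)))

  agrees-odd : ∀ i → to σ i ∈ W₂ → to (extend L) (suc (2 * i)) ≡ to σ i
  agrees-odd i σi∈W₂ = subst (λ j → to (extend L) (suc (2 * j)) ≡ to σ i) (strictlyInverseʳ σ i)
    (extend-agrees L L-injective (∈-++⁺ʳ Lπ (∈-map⁺ (λ w → oddPos w , w) σi∈W₂)))

Distinguishes : (ℕ → ℕ → Set) → InfPerm → InfPerm → Set
Distinguishes R π σ = ∃ λ i → R (to π i) (to σ i)

-- κ≥ G k unfolds to Family (Adj G) k.
Family : (ℕ → ℕ → Set) → ℕ → Set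
Family R k = Σ (Fin k → InfPerm) λ P → ∀ a b → a ≢ b → Distinguishes R (P a) (P b)

SupportedOn : (ℕ → ℕ → Set) → List ℕ → Set
SupportedOn R W = ∀ {x y} → R x y → x ∈ W × y ∈ W

module _ {R S : ℕ → ℕ → Set} where

  family-map : R ⇒ S → ∀ {k} → Family R k → Family S k
  family-map R⇒S (P , P-apart) = P , λ a b a≢b →
    let i , r = P-apart a b a≢b in i , R⇒S r

  family-product : ∀ {W₁ W₂ m n} → SupportedOn R W₁ → SupportedOn S W₂ → Disjoint W₁ W₂ →
                   Family R m → Family S n → Family (R ∪ S) (m * n)
  family-product {W₁} {W₂} {m} {n} R⊆W₁ S⊆W₂ W₁∩W₂≡∅ (P , P-apart) (Q , Q-apart) =
    τ ∘ to *↔× , λ c d c≢d → τ-apart (c≢d ∘ Injection.injective (↔⇒↣ *↔×))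
    where
    τ : Fin m × Fin n → InfPerm
    τ (a , b) = proj₁ (interleave W₁∩W₂≡∅ (P a) (Q b))

    τ-even : ∀ a b i → to (P a) i ∈ W₁ → to (τ (a , b)) (2 * i) ≡ to (P a) i
    τ-even a b = proj₁ (proj₂ (interleave W₁∩W₂≡∅ (P a) (Q b)))

    τ-odd : ∀ a b i → to (Q b) i ∈ W₂ → to (τ (a , b)) (suc (2 * i)) ≡ to (Q b) i
    τ-odd a b = proj₂ (proj₂ (interleave W₁∩W₂≡∅ (P a) (Q b)))

    τ-apart : ∀ {c d} → c ≢ d → Distinguishes (R ∪ S) (τ c) (τ d)
    τ-apart {a , b} {a′ , b′} c≢d with a Finₚ.≟ a′
    ... | no a≢a′ =
      let i , r = P-apart a a′ a≢a′
          x∈W₁ , y∈W₁ = R⊆W₁ r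
      in 2 * i , inj₁ (subst₂ R (sym (τ-even a b i x∈W₁)) (sym (τ-even a′ b′ i y∈W₁)) r)
    ... | yes refl =
      let i , r = Q-apart b b′ (c≢d ∘ cong (a ,_))
          x∈W₂ , y∈W₂ = S⊆W₂ r
      in suc (2 * i) , inj₂ (subst₂ S (sym (τ-odd a b i x∈W₂)) (sym (τ-odd a b′ i y∈W₂)) r)

family-singleton : ∀ {R} → Family R 1
family-singleton = (λ _ → ↔-id ℕ) , λ { Fin.zero Fin.zero 0≢0 → contradiction refl 0≢0 }

Adj-supported : ∀ G → SupportedOn (Adj G) (V G)
Adj-supported G (inj₁ xy∈E) = let x∈V , y∈V , _ = edge-ok G xy∈E in x∈V , y∈V
Adj-supported G (inj₂ yx∈E) = let y∈V , x∈V , _ = edge-ok G yx∈E in x∈V , y∈V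

module _ {s : ℕ} (Gs : Fin s → NatGraph) where

  ⋃V : List ℕ
  ⋃V = concatMap (V ∘ Gs) (allFin s)

  Adj⋃ : ℕ → ℕ → Set
  Adj⋃ x y = ∃ λ i → Adj (Gs i) x y

  ∈-⋃V⁺ : ∀ i {v} → v ∈ V (Gs i) → v ∈ ⋃V
  ∈-⋃V⁺ i v∈Gi = ∈-concat⁺′ v∈Gi (∈-map⁺ (V ∘ Gs) (∈-allFin i))

  ∈-⋃V⁻ : ∀ {v} → v ∈ ⋃V → ∃ λ i → v ∈ V (Gs i)
  ∈-⋃V⁻ v∈⋃V with ∈-concat⁻′ (map (V ∘ Gs) (allFin s)) v∈⋃V
  ... | _ , v∈W , W∈Vs with ∈-map⁻ (V ∘ Gs) W∈Vs
  ...   | i , _ , refl = i , v∈W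

  Adj⋃-supported : SupportedOn Adj⋃ ⋃V
  Adj⋃-supported (i , xy) = let x∈V , y∈V = Adj-supported (Gs i) xy
                            in ∈-⋃V⁺ i x∈V , ∈-⋃V⁺ i y∈V

  VertexDisjoint : Set
  VertexDisjoint = ∀ i j v → v ∈ V (Gs i) → v ∈ V (Gs j) → i ≡ j

family-⋃ : ∀ {s} (Gs : Fin s → NatGraph) → VertexDisjoint Gs →
           ∀ {k} → (∀ i → κ≥ (Gs i) (k i)) → Family (Adj⋃ Gs) (∏ s k)
family-⋃ {zero}  Gs disjoint fams = family-singleton {Adj⋃ Gs}
family-⋃ {suc s} Gs disjoint fams =
  family-map {S = Adj⋃ Gs} head-or-tail
    (family-product (Adj-supported (Gs Fin.zero)) (Adj⋃-supported tail) head∩tail≡∅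
      (fams Fin.zero) (family-⋃ tail tail-disjoint (fams ∘ Fin.suc)))
  where
  tail : Fin s → NatGraph
  tail = Gs ∘ Fin.suc

  tail-disjoint : VertexDisjoint tail
  tail-disjoint i j v v∈i v∈j = Finₚ.suc-injective (disjoint (Fin.suc i) (Fin.suc j) v v∈i v∈j)

  head∩tail≡∅ : Disjoint (V (Gs Fin.zero)) (⋃V tail)
  head∩tail≡∅ (v∈head , v∈tail) =
    let i , v∈Gi = ∈-⋃V⁻ tail v∈tail in 0≢1+n (disjoint Fin.zero (Fin.suc i) _ v∈head v∈Gi)

  head-or-tail : Adj (Gs Fin.zero) ∪ Adj⋃ tail ⇒ Adj⋃ Gs
  head-or-tail (inj₁ xy)       = Fin.zero , xy
  head-or-tail (inj₂ (i , xy)) = Fin.suc i , xy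

lemma2 : (F : NatGraph) (s : ℕ) (Fs : Fin s → NatGraph)
         → (∀ i → Fs i ⊑ F)
         → (∀ i j v → v ∈ V (Fs i) → v ∈ V (Fs j) → i ≡ j)
         → (k : Fin s → ℕ)
         → (∀ i → κ≥ (Fs i) (k i))
         → κ≥ F (∏ s k)
lemma2 F s Fs Fs⊑F disjoint k fams =
  family-map {Adj⋃ Fs} {Adj F} (λ (i , xy) → proj₂ (Fs⊑F i) xy) (family-⋃ Fs disjoint fams)
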